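{- For every integer $m\ge1$, if $x=(x_1,\dots,x_{2m})$ is uniformly distributed on $\{\mathrm{true},\mathrm{false}\}^{2m}$, then $\Pr\big[G_m(x_3,x_4,\dots,x_{2m},x_1)=\mathrm{true}\ \big|\ x_1\vee x_2=\mathrm{true}\big]=2/3$, where $G_m$ is the Boolean function on $2m-1$ variables defined by $G_1(y_1)=y_1$ and $G_{m+1}(y_1,\dots,y_{2m+1})=y_1\vee\big(y_2\wedge G_m(y_3,\dots,y_{2m+1})\big)$ (for $m=1$ the expression is $G_1(x_1)$).
   Context: $\mathrm{true}=-1$, $\mathrm{false}=+1$; $\vee$ and $\wedge$ denote logical disjunction and conjunction of these truth values. -}

module Defs where

open import Data.Bool using (Bool; true; false; _∨_; _∧_)
open import Data.Nat using (ℕ; zero; suc; _*_)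
open import Data.Vec using (Vec; []; _∷_; _∷ʳ_)
open import Data.List using (List; []; _∷_; map; concatMap; length)

-- Truth values: Agda's Bool 'true' plays the role of the paper's true (= -1)
-- and 'false' the role of false (= +1); _∨_ and _∧_ are disjunction/conjunction.

-- double m = 2m, defined by recursion so that vectors of length 2(m+1)
-- decompose definitionally as two heads followed by a vector of length 2m.
double : ℕ → ℕ
double zero = zero
double (suc m) = suc (suc (double m))

-- G k is the paper's G_{k+1}, a Boolean function of 2(k+1)-1 = 2k+1 variables:
--   G_1(y₁) = y₁,   G_{m+1}(y₁,…,y_{2m+1}) = y₁ ∨ (y₂ ∧ G_m(y₃,…,y_{2m+1})).
G : (k : ℕ) → Vec Bool (suc (double k)) → Bool
G zero (y₁ ∷ []) = y₁
G (suc k) (y₁ ∷ y₂ ∷ ys) = y₁ ∨ (y₂ ∧ G k ys)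

-- All 2^n elements of {true,false}^n (the uniform sample space, each with equal weight).
allVecs : (n : ℕ) → List (Vec Bool n)
allVecs zero = [] ∷ []
allVecs (suc n) = concatMap (λ v → (true ∷ v) ∷ (false ∷ v) ∷ []) (allVecs n)

count : (n : ℕ) → (Vec Bool n → Bool) → ℕ
count n P = length (Data.List.filter (λ v → Data.Bool.T? (P v)) (allVecs n))

Cond : (k : ℕ) → Vec Bool (double (suc k)) → Bool
Cond k (x₁ ∷ x₂ ∷ rest) = x₁ ∨ x₂

Event : (k : ℕ) → Vec Bool (double (suc k)) → Bool
Event k (x₁ ∷ x₂ ∷ rest) = G k (rest ∷ʳ x₁)

-- Write Tₖ = 2^(2k) and aₖ(c) for the number of r ∈ {true,false}^(2k) with G_{k+1}(r, c) = true.
-- Splitting on the two leading variables of G_{k+2}(y₁, y₂, r, c) = y₁ ∨ (y₂ ∧ G_{k+1}(r, c)) gives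
-- aₖ₊₁(c) = 2Tₖ + aₖ(c), and with Tₖ₊₁ = 4Tₖ the quantity 2aₖ(true) + aₖ(false) − 2Tₖ is
-- preserved; it vanishes for k = 0, so 2aₖ(true) + aₖ(false) = 2Tₖ.  The event x₁ ∨ x₂ has
-- 3Tₖ points, and on its three cases (x₁, x₂) = (t,t), (t,f), (f,t) the favourable points number
-- aₖ(true), aₖ(true) and aₖ(false), whence the conditional probability 2Tₖ / 3Tₖ = 2/3.
module Submission where

open import Defs
open import Data.Nat using (ℕ; suc; _*_)
open import Data.Bool using (_∧_)
open import Relation.Binary.PropositionalEquality using (_≡_)

open import Data.Bool using (Bool; true; false; T)
open import Data.Bool.Properties using (∧-identityʳ; ∧-zeroʳ)
open import Data.List using (List; []; _∷_; length; filterᵇ; concatMap)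
open import Data.List.Properties using (filter-≐)
open import Data.Nat using (zero; _+_; _^_)
open import Data.Nat.Properties using (+-suc; +-identityʳ)
open import Data.Product using (_,_)
open import Data.Nat.Tactic.RingSolver using (solve-∀)
open import Data.Vec using (Vec; _∷_; _∷ʳ_)
open import Function using (_∘_)
open import Relation.Binary.PropositionalEquality
  using (_≗_; refl; sym; trans; cong; cong₂; subst; module ≡-Reasoning)

open ≡-Reasoning

length-filterᵇ-concatMap-pair : {A B : Set} (p : A → Bool) (f g : B → A) (xs : List B) →
  length (filterᵇ p (concatMap (λ x → f x ∷ g x ∷ []) xs))
    ≡ length (filterᵇ (p ∘ f) xs) + length (filterᵇ (p ∘ g) xs)
length-filterᵇ-concatMap-pair p f g [] = refl
length-filterᵇ-concatMap-pair p f g (x ∷ xs) with p (f x)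
... | true  with p (g x)
...   | true  = cong suc (trans (cong suc (length-filterᵇ-concatMap-pair p f g xs)) (sym (+-suc _ _)))
...   | false = cong suc (length-filterᵇ-concatMap-pair p f g xs)
length-filterᵇ-concatMap-pair p f g (x ∷ xs) | false with p (g x)
...   | true  = trans (cong suc (length-filterᵇ-concatMap-pair p f g xs)) (sym (+-suc _ _))
...   | false = length-filterᵇ-concatMap-pair p f g xs

count-cong : ∀ n {P Q : Vec Bool n → Bool} → P ≗ Q → count n P ≡ count n Q
count-cong n {P} {Q} P≗Q = cong length
  (filter-≐ _ _ ((λ {v} → subst T (P≗Q v)) , (λ {v} → subst T (sym (P≗Q v)))) (allVecs n))

count-∷ : ∀ n (P : Vec Bool (suc n) → Bool) →
  count (suc n) P ≡ count n (P ∘ (true ∷_)) + count n (P ∘ (false ∷_))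
count-∷ n P = length-filterᵇ-concatMap-pair P (true ∷_) (false ∷_) (allVecs n)

count-∷∷ : ∀ n (P : Vec Bool (suc (suc n)) → Bool) →
  count (suc (suc n)) P
    ≡ count n (λ v → P (true ∷ true ∷ v)) + count n (λ v → P (true ∷ false ∷ v))
      + (count n (λ v → P (false ∷ true ∷ v)) + count n (λ v → P (false ∷ false ∷ v)))
count-∷∷ n P = trans (count-∷ (suc n) P) (cong₂ _+_ (count-∷ n _) (count-∷ n _))

count-false : ∀ n → count n (λ _ → false) ≡ 0
count-false zero = refl
count-false (suc n) = trans (count-∷ n _) (cong₂ _+_ (count-false n) (count-false n))

count-true : ∀ n → count n (λ _ → true) ≡ 2 ^ n
count-true zero = refl
count-true (suc n) = begin
  count (suc n) (λ _ → true)               ≡⟨ count-∷ n _ ⟩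
  count n (λ _ → true) + count n (λ _ → true) ≡⟨ cong₂ _+_ (count-true n) (count-true n) ⟩
  2 ^ n + 2 ^ n                            ≡⟨ cong (2 ^ n +_) (sym (+-identityʳ (2 ^ n))) ⟩
  2 ^ suc n                                ∎

countG : ℕ → Bool → ℕ
countG k c = count (double k) (λ r → G k (r ∷ʳ c))

countG-suc : ∀ k c → countG (suc k) c ≡ 2 ^ double k + 2 ^ double k + countG k c
countG-suc k c = begin
  countG (suc k) c
    ≡⟨ count-∷∷ (double k) _ ⟩
  count d (λ _ → true) + count d (λ _ → true) + (countG k c + count d (λ _ → false))
    ≡⟨ cong₂ _+_ (cong₂ _+_ (count-true d) (count-true d))
                 (trans (cong (countG k c +_) (count-false d)) (+-identityʳ _)) ⟩
  2 ^ d + 2 ^ d + countG k c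
    ∎
  where d = double k

countG-balance : ∀ k → 2 * countG k true + countG k false ≡ 2 * 2 ^ double k
countG-balance zero = refl
countG-balance (suc k) = begin
  2 * countG (suc k) true + countG (suc k) false
    ≡⟨ cong₂ (λ a b → 2 * a + b) (countG-suc k true) (countG-suc k false) ⟩
  2 * (N + N + a) + (N + N + b)           ≡⟨ regroup N a b ⟩
  6 * N + (2 * a + b)                     ≡⟨ cong (6 * N +_) (countG-balance k) ⟩
  6 * N + 2 * N                           ≡⟨ quadruple N ⟩
  2 * 2 ^ double (suc k)                  ∎
  where
  N = 2 ^ double k
  a = countG k true
  b = countG k false
  regroup : ∀ N a b → 2 * (N + N + a) + (N + N + b) ≡ 6 * N + (2 * a + b)
  regroup = solve-∀
  quadruple : ∀ N → 6 * N + 2 * N ≡ 2 * (2 * (2 * N))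
  quadruple = solve-∀

count-Event∧Cond : ∀ k →
  count (double (suc k)) (λ x → Event k x ∧ Cond k x) ≡ countG k true + countG k true + countG k false
count-Event∧Cond k = begin
  count (double (suc k)) (λ x → Event k x ∧ Cond k x)
    ≡⟨ count-∷∷ d _ ⟩
  count d (λ r → G k (r ∷ʳ true) ∧ true) + count d (λ r → G k (r ∷ʳ true) ∧ true)
    + (count d (λ r → G k (r ∷ʳ false) ∧ true) + count d (λ r → G k (r ∷ʳ false) ∧ false))
    ≡⟨ cong₂ _+_ (cong₂ _+_ (count-cong d (∧-identityʳ ∘ _)) (count-cong d (∧-identityʳ ∘ _)))
                 (cong₂ _+_ (count-cong d (∧-identityʳ ∘ _))
                            (trans (count-cong d (∧-zeroʳ ∘ _)) (count-false d))) ⟩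
  countG k true + countG k true + (countG k false + 0)
    ≡⟨ cong (countG k true + countG k true +_) (+-identityʳ _) ⟩
  countG k true + countG k true + countG k false
    ∎
  where d = double k

count-Cond : ∀ k → count (double (suc k)) (Cond k) ≡ 3 * 2 ^ double k
count-Cond k = begin
  count (double (suc k)) (Cond k)          ≡⟨ count-∷∷ d _ ⟩
  count d (λ _ → true) + count d (λ _ → true) + (count d (λ _ → true) + count d (λ _ → false))
    ≡⟨ cong₂ _+_ (cong₂ _+_ (count-true d) (count-true d))
                 (cong₂ _+_ (count-true d) (count-false d)) ⟩
  2 ^ d + 2 ^ d + (2 ^ d + 0)              ≡⟨ triple (2 ^ d) ⟩
  3 * 2 ^ d                                ∎
  where
  d = double k
  triple : ∀ N → N + N + (N + 0) ≡ 3 * N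
  triple = solve-∀

claim3 : (k : ℕ) →
    3 * count (double (suc k)) (λ x → Event k x ∧ Cond k x) ≡ 2 * count (double (suc k)) (Cond k)
claim3 k = begin
  3 * count (double (suc k)) (λ x → Event k x ∧ Cond k x) ≡⟨ cong (3 *_) (count-Event∧Cond k) ⟩
  3 * (a + a + b)                          ≡⟨ cong (3 *_) (double-first a b) ⟩
  3 * (2 * a + b)                          ≡⟨ cong (3 *_) (countG-balance k) ⟩
  3 * (2 * N)                              ≡⟨ swap N ⟩
  2 * (3 * N)                              ≡⟨ cong (2 *_) (count-Cond k) ⟨
  2 * count (double (suc k)) (Cond k)      ∎
  where
  N = 2 ^ double k
  a = countG k true
  b = countG k false
  double-first : ∀ a b → a + a + b ≡ 2 * a + b
  double-first = solve-∀
  swap : ∀ N → 3 * (2 * N) ≡ 2 * (3 * N)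
  swap = solve-∀
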